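{- Let $Z$ be a multimatroid with a total ordering $\prec$ of its skew classes. Let $T$ be a $(Z,\prec)$-cocompatible transversal and let $T'$ be a transversal of $Z$. Then $\mathrm{ccl}_{\prec}(T')=T$ if and only if $T'_{\omega} = T_{\omega}$ for every skew class $\omega$ that is inactive with respect to $T$.
   Context: A carrier is a pair $(U,\Omega)$, $U$ finite, $\Omega$ a partition of $U$ into non-empty skew classes; subtransversals meet each skew class at most once, transversals exactly once; skew pair: two distinct elements of a skew class. A multimatroid $Z=(U,\Omega,r)$ has a non-negative integer $r$ on subtransversals with (R1) on each transversal $r$ is a matroid rank function; (R2) for subtransversal $S$ and skew pair $\{x,y\}$ in a skew class disjoint from $S$, $r(S\cup\{x\})+r(S\cup\{y\})-2r(S)\ge1$. Circuits are minimal subtransversals $S$ with $r(S)<|S|$. $S_\omega$ is the element of $S\cap\omega$. The total order $\prec$ on skew classes induces an order on any subtransversal; $\min(C)$ is its least element. For a transversal $T$, skew class $\omega$ is active w.r.t. $T$ if there is a circuit $C$ with $\min(C)\in\omega$ and $C-\omega\subseteq T$, inactive otherwise; all such circuits have the same least element, denoted $\underline T_\omega$. $\mathrm{ccl}_\prec(T)$ is the transversal with $(\mathrm{ccl}_\prec(T))_\omega=\underline T_\omega$ for active $\omega$ and $T_\omega$ for inactive $\omega$. $T$ is $(Z,\prec)$-cocompatible if no circuit $C$ satisfies $C-T=\{\min(C)\}$. -}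

module Defs where

open import Data.Nat using (ℕ; _+_; _*_; _≤_; _<_; suc)
open import Data.Fin using (Fin)
open import Data.Fin.Subset using (Subset; _∈_; _∉_; _⊆_; _∪_; _∩_; ⁅_⁆; ∣_∣)
open import Data.Product using (Σ; ∃; _×_; _,_)
open import Relation.Binary.PropositionalEquality using (_≡_; _≢_)
open import Relation.Binary.Structures using (IsStrictTotalOrder)
open import Relation.Nullary using (¬_)
open import Function.Bundles using (_⇔_)

-- Carrier: ground set U = Fin m, skew classes Ω = Fin n,
-- cls x = the skew class containing x.  Every skew class is non-empty.
-- Subsets of U are Data.Fin.Subset (Vec Bool m).
record Multimatroid (m n : ℕ) : Set where
  field
    cls      : Fin m → Fin n
    nonempty : ∀ (ω : Fin n) → ∃ λ x → cls x ≡ ω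
    r        : Subset m → ℕ   -- only its values on subtransversals matter

  SubTrans : Subset m → Set
  SubTrans S = ∀ x y → x ∈ S → y ∈ S → cls x ≡ cls y → x ≡ y

  Transversal : Subset m → Set
  Transversal T = SubTrans T × (∀ ω → ∃ λ x → cls x ≡ ω × x ∈ T)

  field
    -- (R1): on each transversal T, r is a matroid rank function on the ground set T
    R1-bound  : ∀ T → Transversal T → ∀ A → A ⊆ T → r A ≤ ∣ A ∣
    R1-mono   : ∀ T → Transversal T → ∀ A B → A ⊆ T → B ⊆ T → A ⊆ B → r A ≤ r B
    R1-submod : ∀ T → Transversal T → ∀ A B → A ⊆ T → B ⊆ T →
                r (A ∪ B) + r (A ∩ B) ≤ r A + r B
    R2 : ∀ S x y → SubTrans S → cls x ≡ cls y → x ≢ y →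
         (∀ z → z ∈ S → cls z ≢ cls x) →
         suc (2 * r S) ≤ r (S ∪ ⁅ x ⁆) + r (S ∪ ⁅ y ⁆)

  Dependent : Subset m → Set
  Dependent S = SubTrans S × r S < ∣ S ∣

  IsCircuit : Subset m → Set
  IsCircuit C = Dependent C × (∀ D → D ⊆ C → D ≢ C → ¬ Dependent D)

  _at_is_ : Subset m → Fin n → Fin m → Set
  T at ω is x = cls x ≡ ω × x ∈ T

  SameAt : Subset m → Subset m → Fin n → Set
  SameAt T T' ω = ∀ x → (T at ω is x) ⇔ (T' at ω is x)

  module Ordered (_≺_ : Fin n → Fin n → Set) where

    IsMin : Subset m → Fin m → Set
    IsMin C x = x ∈ C × (∀ y → y ∈ C → y ≢ x → cls x ≺ cls y)

    Underline : Subset m → Fin n → Fin m → Set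
    Underline T ω x = ∃ λ C → IsCircuit C × IsMin C x × cls x ≡ ω ×
                      (∀ y → y ∈ C → cls y ≢ ω → y ∈ T)

    Active : Subset m → Fin n → Set
    Active T ω = ∃ λ x → Underline T ω x

    Inactive : Subset m → Fin n → Set
    Inactive T ω = ¬ Active T ω

    -- ccl(T) = T''  (pointwise definition of ccl)
    CclIs : Subset m → Subset m → Set
    CclIs T T'' = Transversal T'' ×
      (∀ ω → (∀ x → Underline T ω x → T'' at ω is x) ×
             (Inactive T ω → SameAt T'' T ω))

    Cocompatible : Subset m → Set
    Cocompatible T = Transversal T ×
      ¬ (∃ λ C → ∃ λ x → IsCircuit C × IsMin C x × x ∉ T ×
           (∀ y → y ∈ C → y ≢ x → y ∈ T))

{-# OPTIONS --safe #-}
module Submission where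

-- Write X≻ω for the elements of a transversal X in classes above ω.  The class ω is active
-- with underline x exactly when x lies in the closure of X≻ω: a circuit with least element x
-- and its other elements in X≻ω is a witness.  Call transversals B and E exchangeable when in
-- every class ω′ their elements agree or one of them lies in the closure of B≻ω′.  Then B can
-- be turned into E one class ω′ at a time without changing any of these closures: for ω ⊀ ω′
-- the part above ω is untouched, and for ω ≺ ω′ a spanned element of ω′ may be traded for
-- its skew partner because, by (R2), no set avoiding ω′ spans both.  Hence exchangeable
-- transversals have the same underlines.  Both ccl(T′) = T and the agreement of T′ with T on
-- the T-inactive classes make T′ and T exchangeable, and cocompatibility of T puts every
-- underline of T inside T.

open import Defs
open import Data.Bool.Properties using (T-≡)
open import Data.Empty using (⊥; ⊥-elim)
open import Data.Fin.Base as Fin using (Fin)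
open import Data.Fin.Properties using (any?) renaming (_≟_ to _≟ᶠ_)
open import Data.Fin.Subset hiding (⊥)
open import Data.Fin.Subset.Induction using (Acc; acc; ⊂-wellFounded)
open import Data.Fin.Subset.Properties
open import Data.List.Base using (List; []; _∷_; allFin)
open import Data.List.Membership.Propositional using () renaming (_∈_ to _∈ₗ_)
open import Data.List.Membership.Propositional.Properties using (∈-allFin)
import Data.List.Relation.Unary.Any as Any
open import Data.Nat.Base using (ℕ; suc; _+_; _*_; _<_; _≤_; z≤n; s≤s)
open import Data.Nat.Properties
open import Data.Product using (∃; _×_; _,_; proj₁; proj₂; map₂)
open import Data.Sum.Base as Sum using (_⊎_; inj₁; inj₂)
open import Data.Vec.Base using (tabulate; _∷_; here; there)
open import Data.Vec.Properties using (lookup∘tabulate; lookup⇒[]=; []=⇒lookup)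
open import Function.Base using (_∘_)
open import Function.Bundles using (Equivalence; _⇔_; mk⇔)
open import Function.Properties.Equivalence using (⇔-setoid)
  renaming (refl to ⇔-refl; sym to ⇔-sym; trans to ⇔-trans)
open import Level using (Level; 0ℓ)
import Relation.Binary.Reasoning.Setoid
open import Relation.Binary.PropositionalEquality
  using (_≡_; _≢_; refl; trans; sym; cong; subst; module ≡-Reasoning)
open import Relation.Binary.Structures using (IsStrictTotalOrder)
open import Relation.Nullary using (¬_; yes; no; contradiction)
open import Relation.Nullary.Decidable
  using (_×-dec_; ¬?; ⌊_⌋; fromWitness; toWitness; decidable-stable)
open import Relation.Unary using (Pred; Decidable)

open Equivalence using (to; from)
module ⇔-Reasoning = Relation.Binary.Reasoning.Setoid (⇔-setoid 0ℓ)

private variable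
  ℓ : Level
  k : ℕ
  p q : Subset k
  x : Fin k

select : {P : Pred (Fin k) ℓ} → Decidable P → Subset k
select P? = tabulate (λ i → ⌊ P? i ⌋)

module _ {P : Pred (Fin k) ℓ} (P? : Decidable P) where

  ∈-select⁺ : P x → x ∈ select P?
  ∈-select⁺ {x} px = lookup⇒[]= x _ (trans (lookup∘tabulate _ x) (to T-≡ (fromWitness px)))

  ∈-select⁻ : x ∈ select P? → P x
  ∈-select⁻ {x} x∈ = toWitness (from T-≡ (trans (sym (lookup∘tabulate _ x)) ([]=⇒lookup x∈)))

∪-least : ∀ {r : Subset k} → p ⊆ r → q ⊆ r → p ∪ q ⊆ r
∪-least {p = p} {q} p⊆r q⊆r x∈p∪q with x∈p∪q⁻ p q x∈p∪q
... | inj₁ x∈p = p⊆r x∈p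
... | inj₂ x∈q = q⊆r x∈q

∩-greatest : ∀ {r : Subset k} → r ⊆ p → r ⊆ q → r ⊆ p ∩ q
∩-greatest r⊆p r⊆q x∈r = x∈p∩q⁺ (r⊆p x∈r , r⊆q x∈r)

⁅x⁆⊆p : x ∈ p → ⁅ x ⁆ ⊆ p
⁅x⁆⊆p {x = x} x∈p y∈⁅x⁆ rewrite x∈⁅y⁆⇒x≡y x y∈⁅x⁆ = x∈p

x∉p-x : x ∉ p - x
x∉p-x {x = Fin.zero} {p = _ ∷ _} ()
x∉p-x {x = Fin.suc x} {p = _ ∷ p} (there x∈p-x) = x∉p-x {p = p} x∈p-x

∣p∣≤1+∣p-x∣ : x ∈ p → ∣ p ∣ ≤ suc ∣ p - x ∣
∣p∣≤1+∣p-x∣ {p = inside ∷ p} here = s≤s (≤-reflexive (cong ∣_∣ (sym (p─⊥≡p p))))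
∣p∣≤1+∣p-x∣ {p = inside ∷ p} (there x∈p) = s≤s (∣p∣≤1+∣p-x∣ x∈p)
∣p∣≤1+∣p-x∣ {p = outside ∷ p} (there x∈p) = ∣p∣≤1+∣p-x∣ x∈p

x∈p-y⇒x≢y : ∀ {y} → x ∈ p - y → x ≢ y
x∈p-y⇒x≢y {p = p} x∈p-y refl = x∉p-x {p = p} x∈p-y

p⊆q⇒p-x⊆q-x : p ⊆ q → p - x ⊆ q - x
p⊆q⇒p-x⊆q-x {p = p} {x = x} p⊆q y∈p-x =
  x∈p∧x≢y⇒x∈p-y (p⊆q (p─q⊆p p ⁅ x ⁆ y∈p-x)) (x∈p-y⇒x≢y {p = p} y∈p-x)

p⊆p-x∪⁅x⁆ : p ⊆ (p - x) ∪ ⁅ x ⁆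
p⊆p-x∪⁅x⁆ {p = p} {x = x} {y} y∈p with y ≟ᶠ x
... | yes refl = q⊆p∪q (p - x) ⁅ x ⁆ (x∈⁅x⁆ x)
... | no y≢x = p⊆p∪q ⁅ x ⁆ (x∈p∧x≢y⇒x∈p-y y∈p y≢x)

∪⁅⁆-least : p ⊆ q → x ∈ q → p ∪ ⁅ x ⁆ ⊆ q
∪⁅⁆-least p⊆q x∈q = ∪-least p⊆q (⁅x⁆⊆p x∈q)

p-x∪⁅x⁆⊆p : x ∈ p → (p - x) ∪ ⁅ x ⁆ ⊆ p
p-x∪⁅x⁆⊆p x∈p = ∪⁅⁆-least (p─q⊆p _ _) x∈p

p⊆q∪⁅x⁆⇒p-x⊆q : p ⊆ q ∪ ⁅ x ⁆ → p - x ⊆ q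
p⊆q∪⁅x⁆⇒p-x⊆q {p = p} {q = q} {x = x} p⊆q∪x y∈p-x
  with x∈p∪q⁻ q ⁅ x ⁆ (p⊆q∪x (p─q⊆p p ⁅ x ⁆ y∈p-x))
... | inj₁ y∈q = y∈q
... | inj₂ y∈⁅x⁆ = contradiction (x∈⁅y⁆⇒x≡y x y∈⁅x⁆) (x∈p-y⇒x≢y {p = p} y∈p-x)

p⊆q∧x∉p⇒p⊆q-x : p ⊆ q → x ∉ p → p ⊆ q - x
p⊆q∧x∉p⇒p⊆q-x p⊆q x∉p y∈p = x∈p∧x≢y⇒x∈p-y (p⊆q y∈p) (λ { refl → x∉p y∈p })

∪⊆⇒ˡ : ∀ {s : Subset k} → p ∪ q ⊆ s → p ⊆ s
∪⊆⇒ˡ {q = q} p∪q⊆s = ⊆-trans (p⊆p∪q q) p∪q⊆s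

∪⊆⇒ʳ : ∀ {s : Subset k} → p ∪ q ⊆ s → q ⊆ s
∪⊆⇒ʳ {p = p} p∪q⊆s = ⊆-trans (q⊆p∪q p _) p∪q⊆s

∪-monoˡ-⊆ : ∀ {s : Subset k} → p ⊆ q → p ∪ s ⊆ q ∪ s
∪-monoˡ-⊆ {q = q} {s} p⊆q = ∪-least (⊆-trans p⊆q (p⊆p∪q s)) (q⊆p∪q q s)

∪-monoʳ-⊆ : ∀ {s : Subset k} → q ⊆ s → p ∪ q ⊆ p ∪ s
∪-monoʳ-⊆ {p = p} {s = s} q⊆s = ∪-least (p⊆p∪q s) (⊆-trans q⊆s (q⊆p∪q p s))

∪-swapʳ : ∀ (p q s : Subset k) → (p ∪ q) ∪ s ≡ (p ∪ s) ∪ q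
∪-swapʳ p q s = begin
  (p ∪ q) ∪ s   ≡⟨ ∪-assoc p q s ⟩
  p ∪ (q ∪ s)   ≡⟨ cong (p ∪_) (∪-comm q s) ⟩
  p ∪ (s ∪ q)   ≡⟨ sym (∪-assoc p s q) ⟩
  (p ∪ s) ∪ q   ∎
  where open ≡-Reasoning

0<∣p∣⇒nonempty : 0 < ∣ p ∣ → Nonempty p
0<∣p∣⇒nonempty {p = inside ∷ p} _ = Fin.zero , here
0<∣p∣⇒nonempty {p = outside ∷ p} 0<∣p∣ with 0<∣p∣⇒nonempty 0<∣p∣
... | x , x∈p = Fin.suc x , there x∈p

⊆∧≢⇒⊂ : p ⊆ q → p ≢ q → p ⊂ q
⊆∧≢⇒⊂ {p = p} {q} p⊆q p≢q with any? (λ x → x ∈? q ×-dec ¬? (x ∈? p))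
... | yes witness = p⊆q , witness
... | no none = contradiction (⊆-antisym p⊆q q⊆p) p≢q
  where
  q⊆p : q ⊆ p
  q⊆p {x} x∈q = decidable-stable (x ∈? p) (λ x∉p → none (x , x∈q , x∉p))

⊂-minimal : {P : Pred (Subset k) ℓ} → Decidable P → P p →
            ∃ λ c → c ⊆ p × P c × (∀ {d} → d ⊂ c → ¬ P d)
⊂-minimal {P = P} P? = go (⊂-wellFounded _)
  where
  go : ∀ {p} → Acc _⊂_ p → P p → ∃ λ c → c ⊆ p × P c × (∀ {d} → d ⊂ c → ¬ P d)
  go {p} (acc smaller) pp with anySubset? (λ d → d ⊂? p ×-dec P? d)
  ... | no none = p , ⊆-refl , pp , λ d⊂p pd → none (_ , d⊂p , pd)
  ... | yes (d , d⊂p , pd) with go (smaller d⊂p) pd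
  ...   | c , c⊆d , pc , minimal = c , ⊆-trans c⊆d (p⊂q⇒p⊆q d⊂p) , pc , minimal

module Spanning {m n : ℕ} (Z : Multimatroid m n) where
  open Multimatroid Z

  -- x lies in the closure of S; meaningful when S ∪ ⁅ x ⁆ is a subtransversal.
  Spans : Subset m → Fin m → Set
  Spans S x = r (S ∪ ⁅ x ⁆) ≤ r S

  transversal-unique : ∀ {X ω y z} → Transversal X → X at ω is y → X at ω is z → y ≡ z
  transversal-unique (subtrans , _) (y∈ω , y∈X) (z∈ω , z∈X) =
    subtrans _ _ y∈X z∈X (trans y∈ω (sym z∈ω))

  SameAt-sym : ∀ {X Y ω} → SameAt X Y ω → SameAt Y X ω
  SameAt-sym same x = ⇔-sym (same x)

  ⊆-transversal⇒≡ : ∀ {X Y} → Transversal X → Transversal Y → Y ⊆ X → X ≡ Y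
  ⊆-transversal⇒≡ {X} {Y} tX tY@(_ , covers) Y⊆X = ⊆-antisym X⊆Y Y⊆X
    where
    X⊆Y : X ⊆ Y
    X⊆Y {x} x∈X with covers (cls x)
    ... | y , y∈ω , y∈Y rewrite transversal-unique tX (refl , x∈X) (y∈ω , Y⊆X y∈Y) = y∈Y

  ¬spans-skew-pair : ∀ {S a b} → SubTrans S → cls a ≡ cls b → a ≢ b →
                     (∀ z → z ∈ S → cls z ≢ cls a) → Spans S a → Spans S b → ⊥
  ¬spans-skew-pair {S} {a} {b} subtrans a~b a≢b S∌ω S-spans-a S-spans-b =
    n≮n (r S + r S) (begin-strict
      r S + r S                    ≡⟨ cong (r S +_) (sym (+-identityʳ (r S))) ⟩
      2 * r S                      <⟨ R2 S a b subtrans a~b a≢b S∌ω ⟩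
      r (S ∪ ⁅ a ⁆) + r (S ∪ ⁅ b ⁆) ≤⟨ +-mono-≤ S-spans-a S-spans-b ⟩
      r S + r S                    ∎)
    where open ≤-Reasoning

  module InTransversal {W : Subset m} (tW : Transversal W) where

    r-mono : ∀ {A B} → B ⊆ W → A ⊆ B → r A ≤ r B
    r-mono {A} {B} B⊆W A⊆B = R1-mono W tW A B (⊆-trans A⊆B B⊆W) B⊆W A⊆B

    r-submodular : ∀ {A B} → A ⊆ W → B ⊆ W → r (A ∪ B) + r (A ∩ B) ≤ r A + r B
    r-submodular {A} {B} = R1-submod W tW A B

    r-∪⁅⁆≤ : ∀ {A y} → A ⊆ W → y ∈ W → r (A ∪ ⁅ y ⁆) ≤ suc (r A)
    r-∪⁅⁆≤ {A} {y} A⊆W y∈W = begin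
      r (A ∪ ⁅ y ⁆)                        ≤⟨ m≤m+n _ _ ⟩
      r (A ∪ ⁅ y ⁆) + r (A ∩ ⁅ y ⁆)         ≤⟨ r-submodular A⊆W (⁅x⁆⊆p y∈W) ⟩
      r A + r ⁅ y ⁆                        ≤⟨ +-monoʳ-≤ (r A) (R1-bound W tW ⁅ y ⁆ (⁅x⁆⊆p y∈W)) ⟩
      r A + ∣ ⁅ y ⁆ ∣                      ≡⟨ cong (r A +_) (∣⁅x⁆∣≡1 y) ⟩
      r A + 1                              ≡⟨ +-comm (r A) 1 ⟩
      suc (r A)                            ∎
      where open ≤-Reasoning

    spans-mono : ∀ {A B y} → A ⊆ B → B ⊆ W → y ∈ W → Spans A y → Spans B y
    spans-mono {A} {B} {y} A⊆B B⊆W y∈W A-spans-y = begin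
      r (B ∪ ⁅ y ⁆)        ≤⟨ r-mono (∪-least B⊆W Ay⊆W) (∪-monoʳ-⊆ (q⊆p∪q A ⁅ y ⁆)) ⟩
      r (B ∪ (A ∪ ⁅ y ⁆))  ≤⟨ +-cancelʳ-≤ (r A) _ _ cancellable ⟩
      r B                  ∎
      where
      open ≤-Reasoning
      Ay⊆W = ∪⁅⁆-least (⊆-trans A⊆B B⊆W) y∈W
      A⊆B∩Ay = ∩-greatest A⊆B (p⊆p∪q ⁅ y ⁆)
      B∩Ay⊆W = ⊆-trans (p∩q⊆p B _) B⊆W
      cancellable : r (B ∪ (A ∪ ⁅ y ⁆)) + r A ≤ r B + r A
      cancellable = begin
        r (B ∪ (A ∪ ⁅ y ⁆)) + r A                  ≤⟨ +-monoʳ-≤ _ (r-mono B∩Ay⊆W A⊆B∩Ay) ⟩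
        r (B ∪ (A ∪ ⁅ y ⁆)) + r (B ∩ (A ∪ ⁅ y ⁆))  ≤⟨ r-submodular B⊆W Ay⊆W ⟩
        r B + r (A ∪ ⁅ y ⁆)                        ≤⟨ +-monoʳ-≤ (r B) A-spans-y ⟩
        r B + r A                                  ∎

    ⊆W⇒subtransversal : ∀ {A} → A ⊆ W → SubTrans A
    ⊆W⇒subtransversal A⊆W x y x∈A y∈A = proj₁ tW x y (A⊆W x∈A) (A⊆W y∈A)

    spans-removed⇒r≤ : ∀ {D x} → D ⊆ W → x ∈ W → Spans (D - x) x → r D ≤ r (D - x)
    spans-removed⇒r≤ {D} {x} D⊆W x∈W D-x-spans-x =
      ≤-trans (r-mono (∪⁅⁆-least (⊆-trans (p─q⊆p D ⁅ x ⁆) D⊆W) x∈W) p⊆p-x∪⁅x⁆) D-x-spans-x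

    independent-removed⇒spans : ∀ {D x} → D ⊆ W → x ∈ D → r D < ∣ D ∣ → ∣ D - x ∣ ≤ r (D - x) →
                                Spans (D - x) x
    independent-removed⇒spans {D} {x} D⊆W x∈D dependent independent = begin
      r ((D - x) ∪ ⁅ x ⁆)   ≤⟨ r-mono D⊆W (p-x∪⁅x⁆⊆p x∈D) ⟩
      r D                   ≤⟨ ≤-pred r[D]<1+r[D-x] ⟩
      r (D - x)             ∎
      where
      open ≤-Reasoning
      r[D]<1+r[D-x] : r D < suc (r (D - x))
      r[D]<1+r[D-x] = <-≤-trans dependent (≤-trans (∣p∣≤1+∣p-x∣ x∈D) (s≤s independent))

    circuit⇒spans-removed : ∀ {C x} → C ⊆ W → IsCircuit C → x ∈ C → Spans (C - x) x
    circuit⇒spans-removed {C} {x} C⊆W ((_ , dependent) , minimal) x∈C =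
      independent-removed⇒spans C⊆W x∈C dependent (≮⇒≥ λ dependent′ →
        minimal (C - x) C-x⊆C C-x≢C (⊆W⇒subtransversal (⊆-trans C-x⊆C C⊆W) , dependent′))
      where
      C-x⊆C = p─q⊆p C ⁅ x ⁆
      C-x≢C : C - x ≢ C
      C-x≢C C-x≡C = x∉p-x {p = C} (subst (x ∈_) (sym C-x≡C) x∈C)

    circuit⇒spans : ∀ {S C x} → S ⊆ W → x ∈ W → IsCircuit C → x ∈ C → C ⊆ S ∪ ⁅ x ⁆ → Spans S x
    circuit⇒spans S⊆W x∈W circuit x∈C C⊆S∪x =
      spans-mono (p⊆q∪⁅x⁆⇒p-x⊆q C⊆S∪x) S⊆W x∈W
        (circuit⇒spans-removed (⊆-trans C⊆S∪x (∪⁅⁆-least S⊆W x∈W)) circuit x∈C)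

    dependent⇒spans-removed : ∀ {E} → E ⊆ W → r E < ∣ E ∣ → ∃ λ y → y ∈ E × Spans (E - y) y
    dependent⇒spans-removed {E} E⊆W dependent
      with ⊂-minimal (λ D → r D <? ∣ D ∣) dependent
    ... | E₀ , E₀⊆E , dependent₀ , minimal with 0<∣p∣⇒nonempty (≤-<-trans z≤n dependent₀)
    ... | y , y∈E₀ = y , E₀⊆E y∈E₀ ,
      spans-mono (p⊆q⇒p-x⊆q-x E₀⊆E) (⊆-trans (p─q⊆p E ⁅ y ⁆) E⊆W) (E⊆W (E₀⊆E y∈E₀))
        (independent-removed⇒spans (⊆-trans E₀⊆E E⊆W) y∈E₀ dependent₀
          (≮⇒≥ (minimal (x∈p⇒p-x⊂p y∈E₀))))

    spans-minimal⇒circuit : ∀ {C x} → C ⊆ W → x ∈ C → Spans (C - x) x →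
                            (∀ {D} → D ⊂ C → ¬ (x ∈ D × Spans (D - x) x)) → IsCircuit C
    spans-minimal⇒circuit {C} {x} C⊆W x∈C C-x-spans-x minimal = dependent , only-C-dependent
      where
      open ≤-Reasoning
      x∈W = C⊆W x∈C
      C-x⊆W = ⊆-trans (p─q⊆p C ⁅ x ⁆) C⊆W

      dependent : Dependent C
      dependent = ⊆W⇒subtransversal C⊆W , (begin-strict
        r C                  ≤⟨ spans-removed⇒r≤ C⊆W x∈W C-x-spans-x ⟩
        r (C - x)            ≤⟨ R1-bound W tW (C - x) C-x⊆W ⟩
        ∣ C - x ∣            <⟨ x∈p⇒∣p-x∣<∣p∣ x∈C ⟩
        ∣ C ∣                ∎)

      C-x-independent : ∀ {E} → E ⊆ C - x → ¬ r E < ∣ E ∣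
      C-x-independent {E} E⊆C-x dependentE
        with dependent⇒spans-removed (⊆-trans E⊆C-x C-x⊆W) dependentE
      ... | y , y∈E , E-y-spans-y = minimal (x∈p⇒p-x⊂p y∈C) (x∈C-y , C-y-x-spans-x)
        where
        y∈C = p─q⊆p C ⁅ x ⁆ (E⊆C-x y∈E)
        x∈C-y = x∈p∧x≢y⇒x∈p-y x∈C (λ x≡y → x∈p-y⇒x≢y {p = C} (E⊆C-x y∈E) (sym x≡y))
        C-y⊆W = ⊆-trans (p─q⊆p C ⁅ y ⁆) C⊆W
        C-x-y-spans-y = spans-mono (p⊆q⇒p-x⊆q-x E⊆C-x) (⊆-trans (p─q⊆p (C - x) ⁅ y ⁆) C-x⊆W)
                                   (C⊆W y∈C) E-y-spans-y
        C-y-x-spans-x : Spans (C - y - x) x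
        C-y-x-spans-x = begin
          r ((C - y - x) ∪ ⁅ x ⁆)  ≤⟨ r-mono C-y⊆W (p-x∪⁅x⁆⊆p x∈C-y) ⟩
          r (C - y)                ≤⟨ r-mono C⊆W (p─q⊆p C ⁅ y ⁆) ⟩
          r C                      ≤⟨ spans-removed⇒r≤ C⊆W x∈W C-x-spans-x ⟩
          r (C - x)                ≤⟨ spans-removed⇒r≤ C-x⊆W (C⊆W y∈C) C-x-y-spans-y ⟩
          r (C - x - y)            ≡⟨ cong r (p─x─y≡p─y─x C x y) ⟩
          r (C - y - x)            ∎

      only-C-dependent : ∀ D → D ⊆ C → D ≢ C → ¬ Dependent D
      only-C-dependent D D⊆C D≢C (_ , dependentD) with x ∈? D
      ... | no x∉D = C-x-independent (p⊆q∧x∉p⇒p⊆q-x D⊆C x∉D) dependentD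
      ... | yes x∈D = C-x-independent (p⊆q⇒p-x⊆q-x D⊆C) D-x-dependent
        where
        D-x-dependent : r (D - x) < ∣ D - x ∣
        D-x-dependent = ≰⇒> λ D-x-independent → minimal (⊆∧≢⇒⊂ D⊆C D≢C)
          (x∈D , independent-removed⇒spans (⊆-trans D⊆C C⊆W) x∈D dependentD D-x-independent)

    spans⇒circuit : ∀ {S x} → S ⊆ W → x ∈ W → x ∉ S → Spans S x →
                    ∃ λ C → IsCircuit C × x ∈ C × C ⊆ S ∪ ⁅ x ⁆
    spans⇒circuit {S} {x} S⊆W x∈W x∉S S-spans-x
      with ⊂-minimal (λ C → x ∈? C ×-dec (r ((C - x) ∪ ⁅ x ⁆) ≤? r (C - x)))
             (q⊆p∪q S ⁅ x ⁆ (x∈⁅x⁆ x) ,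
              spans-mono (p⊆q∧x∉p⇒p⊆q-x (p⊆p∪q ⁅ x ⁆) x∉S)
                         (⊆-trans (p─q⊆p _ ⁅ x ⁆) (∪⁅⁆-least S⊆W x∈W)) x∈W S-spans-x)
    ... | C , C⊆S∪x , (x∈C , C-x-spans-x) , minimal =
      C , spans-minimal⇒circuit (⊆-trans C⊆S∪x (∪⁅⁆-least S⊆W x∈W)) x∈C C-x-spans-x minimal ,
      x∈C , C⊆S∪x

    spans-absorb : ∀ {P a x} → P ⊆ W → a ∈ W → x ∈ W → Spans P a → Spans (P ∪ ⁅ a ⁆) x ⇔ Spans P x
    spans-absorb {P} {a} {x} P⊆W a∈W x∈W P-spans-a =
      mk⇔ absorb (spans-mono (p⊆p∪q ⁅ a ⁆) Pa⊆W x∈W)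
      where
      Pa⊆W = ∪⁅⁆-least P⊆W a∈W
      absorb : Spans (P ∪ ⁅ a ⁆) x → Spans P x
      absorb Pa-spans-x = begin
        r (P ∪ ⁅ x ⁆)            ≤⟨ r-mono (∪⁅⁆-least Pa⊆W x∈W) (∪-monoˡ-⊆ (p⊆p∪q ⁅ a ⁆)) ⟩
        r ((P ∪ ⁅ a ⁆) ∪ ⁅ x ⁆)  ≤⟨ Pa-spans-x ⟩
        r (P ∪ ⁅ a ⁆)            ≤⟨ P-spans-a ⟩
        r P                      ∎
        where open ≤-Reasoning

  module Exchange {Wa Wb P₀ P a b x} (tWa : Transversal Wa) (tWb : Transversal Wb)
           (Pax⊆Wa : (P ∪ ⁅ a ⁆) ∪ ⁅ x ⁆ ⊆ Wa) (Pbx⊆Wb : (P ∪ ⁅ b ⁆) ∪ ⁅ x ⁆ ⊆ Wb)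
           (P₀⊆P : P₀ ⊆ P) (a~b : cls a ≡ cls b) (Px∌ω : ∀ z → z ∈ P ∪ ⁅ x ⁆ → cls z ≢ cls a) where
    private
      module A = InTransversal tWa
      module B = InTransversal tWb
      P⊆Wa = ∪⊆⇒ˡ (∪⊆⇒ˡ Pax⊆Wa)
      a∈Wa = ∪⊆⇒ʳ (∪⊆⇒ˡ Pax⊆Wa) (x∈⁅x⁆ a)
      x∈Wa = ∪⊆⇒ʳ Pax⊆Wa (x∈⁅x⁆ x)
      P⊆Wb = ∪⊆⇒ˡ (∪⊆⇒ˡ Pbx⊆Wb)
      b∈Wb = ∪⊆⇒ʳ (∪⊆⇒ˡ Pbx⊆Wb) (x∈⁅x⁆ b)
      x∈Wb = ∪⊆⇒ʳ Pbx⊆Wb (x∈⁅x⁆ x)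

    -- If P ∪ ⁅ x ⁆ spanned both a and its skew partner b, (R2) would fail.
    spans-skew⇒spans : Spans P a → Spans (P ∪ ⁅ b ⁆) x → Spans P x
    spans-skew⇒spans P-spans-a Pb-spans-x with a ≟ᶠ b | r (P ∪ ⁅ x ⁆) ≤? r P
    ... | yes refl | _ = to (B.spans-absorb P⊆Wb b∈Wb x∈Wb P-spans-a) Pb-spans-x
    ... | no _ | yes P-spans-x = P-spans-x
    ... | no a≢b | no ¬P-spans-x = ⊥-elim (¬spans-skew-pair (A.⊆W⇒subtransversal Px⊆Wa) a~b a≢b Px∌ω
                                     (A.spans-mono (p⊆p∪q ⁅ x ⁆) Px⊆Wa a∈Wa P-spans-a) Px-spans-b)
      where
      open ≤-Reasoning
      Px⊆Wa = ∪⁅⁆-least P⊆Wa x∈Wa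
      Px-spans-b : Spans (P ∪ ⁅ x ⁆) b
      Px-spans-b = begin
        r ((P ∪ ⁅ x ⁆) ∪ ⁅ b ⁆)  ≡⟨ cong r (∪-swapʳ P ⁅ x ⁆ ⁅ b ⁆) ⟩
        r ((P ∪ ⁅ b ⁆) ∪ ⁅ x ⁆)  ≤⟨ Pb-spans-x ⟩
        r (P ∪ ⁅ b ⁆)            ≤⟨ B.r-∪⁅⁆≤ P⊆Wb b∈Wb ⟩
        suc (r P)                ≤⟨ ≰⇒> ¬P-spans-x ⟩
        r (P ∪ ⁅ x ⁆)            ∎

    spanned-exchange : Spans P₀ a → Spans (P ∪ ⁅ a ⁆) x ⇔ Spans (P ∪ ⁅ b ⁆) x
    spanned-exchange P₀-spans-a = ⇔-trans (A.spans-absorb P⊆Wa a∈Wa x∈Wa P-spans-a)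
      (mk⇔ (B.spans-mono (p⊆p∪q ⁅ b ⁆) (∪⁅⁆-least P⊆Wb b∈Wb) x∈Wb) (spans-skew⇒spans P-spans-a))
      where P-spans-a = A.spans-mono P₀⊆P P⊆Wa a∈Wa P₀-spans-a

  spans-exchange : ∀ {Wa Wb P₀ P a b x} → Transversal Wa → Transversal Wb →
    (P ∪ ⁅ a ⁆) ∪ ⁅ x ⁆ ⊆ Wa → (P ∪ ⁅ b ⁆) ∪ ⁅ x ⁆ ⊆ Wb → P₀ ⊆ P →
    cls a ≡ cls b → (∀ z → z ∈ P ∪ ⁅ x ⁆ → cls z ≢ cls a) →
    a ≡ b ⊎ Spans P₀ a ⊎ Spans P₀ b → Spans (P ∪ ⁅ a ⁆) x ⇔ Spans (P ∪ ⁅ b ⁆) x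
  spans-exchange _ _ _ _ _ _ _ (inj₁ refl) = ⇔-refl
  spans-exchange tWa tWb Pax⊆Wa Pbx⊆Wb P₀⊆P a~b Px∌ω (inj₂ (inj₁ P₀-spans-a)) =
    Exchange.spanned-exchange tWa tWb Pax⊆Wa Pbx⊆Wb P₀⊆P a~b Px∌ω P₀-spans-a
  spans-exchange tWa tWb Pax⊆Wa Pbx⊆Wb P₀⊆P a~b Px∌ω (inj₂ (inj₂ P₀-spans-b)) =
    ⇔-sym (Exchange.spanned-exchange tWb tWa Pbx⊆Wb Pax⊆Wa P₀⊆P (sym a~b)
             (λ z z∈Px z~b → Px∌ω z z∈Px (trans z~b (sym a~b))) P₀-spans-b)

module Ordering {m n : ℕ} (Z : Multimatroid m n) {_≺_ : Fin n → Fin n → Set}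
                (sto : IsStrictTotalOrder _≡_ _≺_) where
  open Multimatroid Z
  open Ordered _≺_
  open Spanning Z
  open IsStrictTotalOrder sto using () renaming (_<?_ to _≺?_; trans to ≺-trans; irrefl to ≺-irrefl)

  ≺⇒≢ : ∀ {ω ω′} → ω ≺ ω′ → ω ≢ ω′
  ≺⇒≢ ω≺ω′ refl = ≺-irrefl refl ω≺ω′

  Above : Subset m → Fin n → Subset m
  Above X ω = select (λ y → y ∈? X ×-dec ω ≺? cls y)

  _∖_ : Subset m → Fin n → Subset m
  X ∖ ω = select (λ y → y ∈? X ×-dec ¬? (cls y ≟ᶠ ω))

  _[_↦_] : Subset m → Fin n → Fin m → Subset m
  X [ ω ↦ x ] = (X ∖ ω) ∪ ⁅ x ⁆

  SpannedAbove : Subset m → Fin n → Fin m → Set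
  SpannedAbove X ω x = Spans (Above X ω) x

  module _ {X : Subset m} {ω : Fin n} {y : Fin m} where

    ∈Above⁺ : y ∈ X → ω ≺ cls y → y ∈ Above X ω
    ∈Above⁺ y∈X ω≺y = ∈-select⁺ (λ z → z ∈? X ×-dec ω ≺? cls z) (y∈X , ω≺y)

    ∈Above⁻ : y ∈ Above X ω → y ∈ X × ω ≺ cls y
    ∈Above⁻ = ∈-select⁻ (λ z → z ∈? X ×-dec ω ≺? cls z)

    ∈∖⁺ : y ∈ X → cls y ≢ ω → y ∈ X ∖ ω
    ∈∖⁺ y∈X y∉ω = ∈-select⁺ (λ z → z ∈? X ×-dec ¬? (cls z ≟ᶠ ω)) (y∈X , y∉ω)

    ∈∖⁻ : y ∈ X ∖ ω → y ∈ X × cls y ≢ ω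
    ∈∖⁻ = ∈-select⁻ (λ z → z ∈? X ×-dec ¬? (cls z ≟ᶠ ω))

    ∈[↦]⁻ : ∀ {x} → y ∈ X [ ω ↦ x ] → (y ∈ X × cls y ≢ ω) ⊎ y ≡ x
    ∈[↦]⁻ {x} y∈ with x∈p∪q⁻ (X ∖ ω) ⁅ x ⁆ y∈
    ... | inj₁ y∈X∖ω = inj₁ (∈∖⁻ y∈X∖ω)
    ... | inj₂ y∈⁅x⁆ = inj₂ (x∈⁅y⁆⇒x≡y x y∈⁅x⁆)

  [↦]-transversal : ∀ {X ω x} → Transversal X → cls x ≡ ω → Transversal (X [ ω ↦ x ])
  [↦]-transversal {X} {ω} {x} (subtrans , covers) x∈ω = subtrans′ , covers′
    where
    subtrans′ : SubTrans (X [ ω ↦ x ])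
    subtrans′ y z y∈ z∈ y~z with ∈[↦]⁻ y∈ | ∈[↦]⁻ z∈
    ... | inj₁ (y∈X , _) | inj₁ (z∈X , _) = subtrans y z y∈X z∈X y~z
    ... | inj₁ (_ , y∉ω) | inj₂ refl = contradiction (trans y~z x∈ω) y∉ω
    ... | inj₂ refl | inj₁ (_ , z∉ω) = contradiction (trans (sym y~z) x∈ω) z∉ω
    ... | inj₂ refl | inj₂ refl = refl
    covers′ : ∀ ω′ → ∃ λ y → cls y ≡ ω′ × y ∈ X [ ω ↦ x ]
    covers′ ω′ with ω′ ≟ᶠ ω | covers ω′
    ... | yes refl | _ = x , x∈ω , q⊆p∪q (X ∖ ω) ⁅ x ⁆ (x∈⁅x⁆ x)
    ... | no ω′≢ω | y , y∈ω′ , y∈X = y , y∈ω′ , p⊆p∪q ⁅ x ⁆ (∈∖⁺ y∈X (ω′≢ω ∘ trans (sym y∈ω′)))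

  Above∪⁅⁆⊆[↦] : ∀ {X ω x} → Above X ω ∪ ⁅ x ⁆ ⊆ X [ ω ↦ x ]
  Above∪⁅⁆⊆[↦] {X} {ω} {x} = ∪-monoˡ-⊆ λ y∈Above →
    let y∈X , ω≺y = ∈Above⁻ y∈Above in ∈∖⁺ y∈X (≺⇒≢ ω≺y ∘ sym)

  module _ {X ω x} (tX : Transversal X) (x∈ω : cls x ≡ ω) where
    private
      module W = InTransversal ([↦]-transversal tX x∈ω)
      Above⊆W = ∪⊆⇒ˡ (Above∪⁅⁆⊆[↦] {X} {ω} {x})
      x∈W = ∪⊆⇒ʳ (Above∪⁅⁆⊆[↦] {X} {ω} {x}) (x∈⁅x⁆ x)
      x∉Above : x ∉ Above X ω
      x∉Above x∈Above = ≺⇒≢ (proj₂ (∈Above⁻ x∈Above)) (sym x∈ω)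

    underline⇒spannedAbove : Underline X ω x → SpannedAbove X ω x
    underline⇒spannedAbove (C , circuit , (x∈C , x-min) , _ , C-ω⊆X) =
      W.circuit⇒spans Above⊆W x∈W circuit x∈C C⊆
      where
      C⊆ : C ⊆ Above X ω ∪ ⁅ x ⁆
      C⊆ {y} y∈C with y ≟ᶠ x
      ... | yes refl = q⊆p∪q _ _ (x∈⁅x⁆ x)
      ... | no y≢x = p⊆p∪q _ (∈Above⁺ (C-ω⊆X y y∈C (≺⇒≢ ω≺y ∘ sym)) ω≺y)
        where ω≺y = subst (_≺ cls y) x∈ω (x-min y y∈C y≢x)

    spannedAbove⇒underline : SpannedAbove X ω x → Underline X ω x
    spannedAbove⇒underline spanned with W.spans⇒circuit Above⊆W x∈W x∉Above spanned
    ... | C , circuit , x∈C , C⊆ = C , circuit , (x∈C , x-min) , x∈ω , C-ω⊆X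
      where
      x-min : ∀ y → y ∈ C → y ≢ x → cls x ≺ cls y
      x-min y y∈C y≢x with x∈p∪q⁻ _ ⁅ x ⁆ (C⊆ y∈C)
      ... | inj₁ y∈Above = subst (_≺ cls y) (sym x∈ω) (proj₂ (∈Above⁻ y∈Above))
      ... | inj₂ y∈⁅x⁆ = contradiction (x∈⁅y⁆⇒x≡y x y∈⁅x⁆) y≢x
      C-ω⊆X : ∀ y → y ∈ C → cls y ≢ ω → y ∈ X
      C-ω⊆X y y∈C y∉ω with x∈p∪q⁻ _ ⁅ x ⁆ (C⊆ y∈C)
      ... | inj₁ y∈Above = proj₁ (∈Above⁻ y∈Above)
      ... | inj₂ y∈⁅x⁆ = contradiction (trans (cong cls (x∈⁅y⁆⇒x≡y x y∈⁅x⁆)) x∈ω) y∉ω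

  underline⇔spannedAbove : ∀ {X ω x} → Transversal X →
                           Underline X ω x ⇔ (cls x ≡ ω × SpannedAbove X ω x)
  underline⇔spannedAbove tX = mk⇔
    (λ u@(_ , _ , _ , x∈ω , _) → x∈ω , underline⇒spannedAbove tX x∈ω u)
    (λ (x∈ω , spanned) → spannedAbove⇒underline tX x∈ω spanned)

  Above-mono : ∀ {A B ω} → A ⊆ B → Above A ω ⊆ Above B ω
  Above-mono A⊆B y∈Above = let y∈A , ω≺y = ∈Above⁻ y∈Above in ∈Above⁺ (A⊆B y∈A) ω≺y

  Above-∪⁅⁆-≺ : ∀ {A ω a} → ω ≺ cls a → Above (A ∪ ⁅ a ⁆) ω ≡ Above A ω ∪ ⁅ a ⁆
  Above-∪⁅⁆-≺ {A} {ω} {a} ω≺a = ⊆-antisym split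
    (∪⁅⁆-least (Above-mono (p⊆p∪q ⁅ a ⁆)) (∈Above⁺ (q⊆p∪q A ⁅ a ⁆ (x∈⁅x⁆ a)) ω≺a))
    where
    split : Above (A ∪ ⁅ a ⁆) ω ⊆ Above A ω ∪ ⁅ a ⁆
    split y∈Above with ∈Above⁻ y∈Above
    ... | y∈A∪a , ω≺y with x∈p∪q⁻ A ⁅ a ⁆ y∈A∪a
    ...   | inj₁ y∈A = p⊆p∪q ⁅ a ⁆ (∈Above⁺ y∈A ω≺y)
    ...   | inj₂ y∈⁅a⁆ = q⊆p∪q (Above A ω) ⁅ a ⁆ y∈⁅a⁆

  Above-∪⁅⁆-⊀ : ∀ {A ω a} → ¬ ω ≺ cls a → Above (A ∪ ⁅ a ⁆) ω ≡ Above A ω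
  Above-∪⁅⁆-⊀ {A} {ω} {a} ω⊀a = ⊆-antisym drop (Above-mono (p⊆p∪q ⁅ a ⁆))
    where
    drop : Above (A ∪ ⁅ a ⁆) ω ⊆ Above A ω
    drop y∈Above with ∈Above⁻ y∈Above
    ... | y∈A∪a , ω≺y with x∈p∪q⁻ A ⁅ a ⁆ y∈A∪a
    ...   | inj₁ y∈A = ∈Above⁺ y∈A ω≺y
    ...   | inj₂ y∈⁅a⁆ = contradiction (subst (λ y → ω ≺ cls y) (x∈⁅y⁆⇒x≡y a y∈⁅a⁆) ω≺y) ω⊀a

  ∖∪⁅⁆≡ : ∀ {X ω a} → Transversal X → X at ω is a → (X ∖ ω) ∪ ⁅ a ⁆ ≡ X
  ∖∪⁅⁆≡ {X} {ω} {a} tX a∈X@(_ , a∈X′) = ⊆-antisym (∪⁅⁆-least (proj₁ ∘ ∈∖⁻) a∈X′) split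
    where
    split : X ⊆ (X ∖ ω) ∪ ⁅ a ⁆
    split {y} y∈X with cls y ≟ᶠ ω
    ... | yes y∈ω rewrite transversal-unique tX (y∈ω , y∈X) a∈X = q⊆p∪q (X ∖ ω) ⁅ a ⁆ (x∈⁅x⁆ a)
    ... | no y∉ω = p⊆p∪q ⁅ a ⁆ (∈∖⁺ y∈X y∉ω)

  module _ {X ω′ a b} (tX : Transversal X) (a∈X : X at ω′ is a) (b∈ω′ : cls b ≡ ω′)
           {ω x} (x∈ω : cls x ≡ ω) where
    private
      open ⇔-Reasoning
      R = X ∖ ω′
      a∈ω′ = proj₁ a∈X
      spans-cong : ∀ {S S′} → S ≡ S′ → Spans S x ≡ Spans S′ x
      spans-cong = cong (λ S → Spans S x)
      Above-X≡ : Above X ω ≡ Above (R ∪ ⁅ a ⁆) ω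
      Above-X≡ = cong (λ Y → Above Y ω) (sym (∖∪⁅⁆≡ tX a∈X))

    spannedAbove-[↦]-⊀ : ¬ ω ≺ ω′ → SpannedAbove X ω x ⇔ SpannedAbove (X [ ω′ ↦ b ]) ω x
    spannedAbove-[↦]-⊀ ω⊀ω′ = begin
      SpannedAbove X ω x                ≡⟨ spans-cong Above-X≡ ⟩
      Spans (Above (R ∪ ⁅ a ⁆) ω) x     ≡⟨ spans-cong (Above-∪⁅⁆-⊀ (ω⊀ω′ ∘ subst (ω ≺_) a∈ω′)) ⟩
      Spans (Above R ω) x               ≡⟨ spans-cong (Above-∪⁅⁆-⊀ (ω⊀ω′ ∘ subst (ω ≺_) b∈ω′)) ⟨
      SpannedAbove (X [ ω′ ↦ b ]) ω x   ∎

    spannedAbove-[↦]-≺ : ω ≺ ω′ → a ≡ b ⊎ SpannedAbove X ω′ a ⊎ SpannedAbove X ω′ b →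
                         SpannedAbove X ω x ⇔ SpannedAbove (X [ ω′ ↦ b ]) ω x
    spannedAbove-[↦]-≺ ω≺ω′ exchangeable = begin
      SpannedAbove X ω x                ≡⟨ spans-cong Above-X≡P∪a ⟩
      Spans (P ∪ ⁅ a ⁆) x               ≈⟨ spans-exchange tWa tWb Pax⊆Wa Pbx⊆Wb Above-X⊆P
                                             (trans a∈ω′ (sym b∈ω′)) Px∌ω′ exchangeable ⟩
      Spans (P ∪ ⁅ b ⁆) x               ≡⟨ spans-cong Above-X′≡P∪b ⟨
      SpannedAbove (X [ ω′ ↦ b ]) ω x   ∎
      where
      P = Above R ω
      Above-X≡P∪a : Above X ω ≡ P ∪ ⁅ a ⁆
      Above-X≡P∪a = trans Above-X≡ (Above-∪⁅⁆-≺ (subst (ω ≺_) (sym a∈ω′) ω≺ω′))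
      Above-X′≡P∪b : Above (X [ ω′ ↦ b ]) ω ≡ P ∪ ⁅ b ⁆
      Above-X′≡P∪b = Above-∪⁅⁆-≺ (subst (ω ≺_) (sym b∈ω′) ω≺ω′)
      tWa = [↦]-transversal tX x∈ω
      tWb = [↦]-transversal ([↦]-transversal tX b∈ω′) x∈ω
      Pax⊆Wa = subst (λ S → S ∪ ⁅ x ⁆ ⊆ X [ ω ↦ x ]) Above-X≡P∪a Above∪⁅⁆⊆[↦]
      Pbx⊆Wb = subst (λ S → S ∪ ⁅ x ⁆ ⊆ X [ ω′ ↦ b ] [ ω ↦ x ]) Above-X′≡P∪b Above∪⁅⁆⊆[↦]
      Above-X⊆P : Above X ω′ ⊆ P
      Above-X⊆P y∈Above = let y∈X , ω′≺y = ∈Above⁻ y∈Above in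
        ∈Above⁺ (∈∖⁺ y∈X (≺⇒≢ ω′≺y ∘ sym)) (≺-trans ω≺ω′ ω′≺y)
      Px∌ω′ : ∀ z → z ∈ P ∪ ⁅ x ⁆ → cls z ≢ cls a
      Px∌ω′ z z∈Px z~a with x∈p∪q⁻ P ⁅ x ⁆ z∈Px
      ... | inj₁ z∈P = proj₂ (∈∖⁻ (proj₁ (∈Above⁻ z∈P))) (trans z~a a∈ω′)
      ... | inj₂ z∈⁅x⁆ = ≺⇒≢ ω≺ω′ (trans (sym x∈ω)
                           (trans (cong cls (sym (x∈⁅y⁆⇒x≡y x z∈⁅x⁆))) (trans z~a a∈ω′)))

  spannedAbove-[↦] : ∀ {X ω′ a b} → Transversal X → X at ω′ is a → cls b ≡ ω′ →
    a ≡ b ⊎ SpannedAbove X ω′ a ⊎ SpannedAbove X ω′ b →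
    ∀ {ω x} → cls x ≡ ω → SpannedAbove X ω x ⇔ SpannedAbove (X [ ω′ ↦ b ]) ω x
  spannedAbove-[↦] {ω′ = ω′} tX a∈X b∈ω′ exchangeable {ω} x∈ω with ω ≺? ω′
  ... | yes ω≺ω′ = spannedAbove-[↦]-≺ tX a∈X b∈ω′ x∈ω ω≺ω′ exchangeable
  ... | no ω⊀ω′ = spannedAbove-[↦]-⊀ tX a∈X b∈ω′ x∈ω ω⊀ω′

  Exchangeable : Subset m → Subset m → Set
  Exchangeable B E = ∀ {ω c e} → B at ω is c → E at ω is e →
                     c ≡ e ⊎ SpannedAbove B ω c ⊎ SpannedAbove B ω e

  module Hybrid {B E} (tB : Transversal B) (tE : Transversal E) (exchangeable : Exchangeable B E)
    where
    private
      e : Fin n → Fin m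
      e ω = proj₁ (proj₂ tE ω)
      e∈E : ∀ ω → E at ω is e ω
      e∈E ω = proj₂ (proj₂ tE ω)

    hybrid : List (Fin n) → Subset m
    hybrid [] = B
    hybrid (ω ∷ L) = hybrid L [ ω ↦ e ω ]

    record Invariant (L : List (Fin n)) : Set where
      field
        transversal  : Transversal (hybrid L)
        spannedAbove : ∀ {ω x} → cls x ≡ ω → SpannedAbove B ω x ⇔ SpannedAbove (hybrid L) ω x
        ⊆B∪E         : hybrid L ⊆ B ∪ E
        agrees       : ∀ {y} → cls y ∈ₗ L → y ∈ E → y ∈ hybrid L

    extend : ∀ {L} ω′ → Invariant L → Invariant (ω′ ∷ L)
    extend {L} ω′ I = record
      { transversal  = [↦]-transversal transversal (proj₁ (e∈E ω′))
      ; spannedAbove = λ x∈ω → ⇔-trans (spannedAbove x∈ω)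
                         (spannedAbove-[↦] transversal a∈X (proj₁ (e∈E ω′)) a-exchangeable x∈ω)
      ; ⊆B∪E         = ⊆B∪E′
      ; agrees       = agrees′
      }
      where
      open Invariant I
      a = proj₁ (proj₂ transversal ω′)
      a∈X = proj₂ (proj₂ transversal ω′)

      a-exchangeable : a ≡ e ω′ ⊎ SpannedAbove (hybrid L) ω′ a ⊎ SpannedAbove (hybrid L) ω′ (e ω′)
      a-exchangeable with x∈p∪q⁻ B E (⊆B∪E (proj₂ a∈X))
      ... | inj₁ a∈B = Sum.map₂ (Sum.map (to (spannedAbove (proj₁ a∈X)))
                                         (to (spannedAbove (proj₁ (e∈E ω′)))))
                                (exchangeable (proj₁ a∈X , a∈B) (e∈E ω′))
      ... | inj₂ a∈E = inj₁ (transversal-unique tE (proj₁ a∈X , a∈E) (e∈E ω′))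

      ⊆B∪E′ : hybrid L [ ω′ ↦ e ω′ ] ⊆ B ∪ E
      ⊆B∪E′ y∈ with ∈[↦]⁻ y∈
      ... | inj₁ (y∈X , _) = ⊆B∪E y∈X
      ... | inj₂ refl = q⊆p∪q B E (proj₂ (e∈E ω′))

      agrees′ : ∀ {y} → cls y ∈ₗ ω′ ∷ L → y ∈ E → y ∈ hybrid L [ ω′ ↦ e ω′ ]
      agrees′ {y} y∈ω′∷L y∈E with cls y ≟ᶠ ω′
      ... | yes y∈ω′ rewrite transversal-unique tE (y∈ω′ , y∈E) (e∈E ω′) = q⊆p∪q _ _ (x∈⁅x⁆ (e ω′))
      ... | no y∉ω′ = p⊆p∪q _ (∈∖⁺ (agrees (Any.tail y∉ω′ y∈ω′∷L) y∈E) y∉ω′)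

    invariant : ∀ L → Invariant L
    invariant [] = record
      { transversal = tB ; spannedAbove = λ _ → ⇔-refl ; ⊆B∪E = p⊆p∪q E ; agrees = λ () }
    invariant (ω′ ∷ L) = extend ω′ (invariant L)

    hybrid-allFin≡E : hybrid (allFin n) ≡ E
    hybrid-allFin≡E = ⊆-transversal⇒≡ transversal tE (λ {y} → agrees (∈-allFin (cls y)))
      where open Invariant (invariant (allFin n))

    spannedAbove-invariant : ∀ {ω x} → cls x ≡ ω → SpannedAbove B ω x ⇔ SpannedAbove E ω x
    spannedAbove-invariant {ω} {x} x∈ω =
      subst (λ Y → SpannedAbove B ω x ⇔ SpannedAbove Y ω x) hybrid-allFin≡E
            (Invariant.spannedAbove (invariant (allFin n)) x∈ω)

  module _ {B E} (tB : Transversal B) (tE : Transversal E) (exchangeable : Exchangeable B E) where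
    open Hybrid tB tE exchangeable using (spannedAbove-invariant)

    underline-invariant : ∀ {ω x} → Underline B ω x ⇔ Underline E ω x
    underline-invariant {ω} {x} = begin
      Underline B ω x                  ≈⟨ underline⇔spannedAbove tB ⟩
      (cls x ≡ ω × SpannedAbove B ω x) ≈⟨ same-spanned ⟩
      (cls x ≡ ω × SpannedAbove E ω x) ≈⟨ underline⇔spannedAbove tE ⟨
      Underline E ω x                  ∎
      where
      open ⇔-Reasoning
      same-spanned : (cls x ≡ ω × SpannedAbove B ω x) ⇔ (cls x ≡ ω × SpannedAbove E ω x)
      same-spanned = mk⇔ (λ (x∈ω , s) → x∈ω , to (spannedAbove-invariant x∈ω) s)
                         (λ (x∈ω , s) → x∈ω , from (spannedAbove-invariant x∈ω) s)

    inactive-invariant : ∀ {ω} → Inactive B ω ⇔ Inactive E ω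
    inactive-invariant = mk⇔ (λ inactive → inactive ∘ map₂ (from underline-invariant))
                             (λ inactive → inactive ∘ map₂ (to underline-invariant))

  exchangeable : ∀ {B E} → Transversal B → Transversal E →
                 (∀ {ω} → Inactive B ω → SameAt E B ω) → (∀ {ω x} → Underline B ω x → x ∈ B ∪ E) →
                 Exchangeable B E
  exchangeable {B} {E} tB tE same-if-inactive underline∈B∪E {ω} {c} {e} c∈B e∈E
    with r (Above B ω ∪ ⁅ c ⁆) ≤? r (Above B ω) | r (Above B ω ∪ ⁅ e ⁆) ≤? r (Above B ω)
  ... | yes c-spanned | _ = inj₂ (inj₁ c-spanned)
  ... | no _ | yes e-spanned = inj₂ (inj₂ e-spanned)
  ... | no c-unspanned | no e-unspanned =
    inj₁ (transversal-unique tB c∈B (to (same-if-inactive inactive e) e∈E))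
    where
    inactive : Inactive B ω
    inactive (x , u) with to (underline⇔spannedAbove tB) u | x∈p∪q⁻ B E (underline∈B∪E u)
    ... | x∈ω , x-spanned | inj₁ x∈B =
      c-unspanned (subst (SpannedAbove B ω) (transversal-unique tB (x∈ω , x∈B) c∈B) x-spanned)
    ... | x∈ω , x-spanned | inj₂ x∈E =
      e-unspanned (subst (SpannedAbove B ω) (transversal-unique tE (x∈ω , x∈E) e∈E) x-spanned)

  cocompatible-underline∈ : ∀ {T ω x} → Cocompatible T → Underline T ω x → x ∈ T
  cocompatible-underline∈ {T} {x = x} (_ , no-circuit)
                          (C , circuit , x-min@(_ , x≺) , x∈ω , C-ω⊆T) =
    decidable-stable (x ∈? T) λ x∉T → no-circuit (C , x , circuit , x-min , x∉T ,
      λ y y∈C y≢x → C-ω⊆T y y∈C (λ y∈ω → ≺⇒≢ (x≺ y y∈C y≢x) (trans x∈ω (sym y∈ω))))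

proposition4p9 : ∀ {m n} (Z : Multimatroid m n) (_≺_ : Fin n → Fin n → Set) →
    IsStrictTotalOrder _≡_ _≺_ →
    let open Multimatroid Z in let open Ordered _≺_ in
    ∀ (T T' : Subset m) → Cocompatible T → Transversal T' →
    CclIs T' T ⇔ (∀ ω → Inactive T ω → SameAt T' T ω)
proposition4p9 Z _≺_ sto T T' cocompatible@(tT , _) tT' = mk⇔ ccl⇒agree agree⇒ccl
  where
  open Multimatroid Z
  open Ordered _≺_
  open Spanning Z using (SameAt-sym)
  open Ordering Z sto

  ccl⇒agree : CclIs T' T → ∀ ω → Inactive T ω → SameAt T' T ω
  ccl⇒agree (_ , ccl) ω T-inactive =
    SameAt-sym (proj₂ (ccl ω) (from (inactive-invariant tT' tT T′~T) T-inactive))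
    where
    T′~T = exchangeable tT' tT (proj₂ (ccl _)) (λ u → q⊆p∪q T' T (proj₂ (proj₁ (ccl _) _ u)))

  agree⇒ccl : (∀ ω → Inactive T ω → SameAt T' T ω) → CclIs T' T
  agree⇒ccl agree = tT , λ ω →
    underline∈T ,
    λ T′-inactive → SameAt-sym (agree ω (from (inactive-invariant tT tT' T~T′) T′-inactive))
    where
    T~T′ = exchangeable tT tT' (agree _) (p⊆p∪q T' ∘ cocompatible-underline∈ cocompatible)
    underline∈T : ∀ {ω} x → Underline T' ω x → T at ω is x
    underline∈T x u@(_ , _ , _ , x∈ω , _) =
      x∈ω , cocompatible-underline∈ cocompatible (from (underline-invariant tT tT' T~T′) u)
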